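{- Let $0<\varepsilon<1/2$, let $k\ge 2$, and let $H=(W_1\cup\cdots\cup W_k,E)$ be a $k$-partite $k$-uniform hypergraph with $|W_i|=m$ for all $i$. If $(W_1,\ldots,W_k)$ is not $\varepsilon$-homogeneous, then there are at least $\varepsilon(1-\varepsilon)m^{k+1}$ pairs of $k$-tuples $(e,e')$ such that $|e\cap e'|=k-1$, $e\in E$, $e'\notin E$, and $|e\cap W_i|=|e'\cap W_i|=1$ for all $i$.
   Context: For a $k$-uniform hypergraph and vertex sets $W_1,\dots,W_k$, the density across them is the number of edges with exactly one vertex in each $W_i$ divided by $|W_1|\cdots|W_k|$; $(W_1,\ldots,W_k)$ is $\varepsilon$-homogeneous if this density is less than $\varepsilon$ or greater than $1-\varepsilon$.
   Formalization: The parameter ε, with $0<\varepsilon<1/2$, ranges over the rationals. -}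

module Defs where

open import Data.Nat as ℕ using (ℕ; zero; suc; NonZero; _^_)
open import Data.Nat.Properties using (m^n≢0)
open import Data.Bool using (Bool; true; false; not; _∧_; if_then_else_)
open import Data.Fin as Fin using (Fin)
open import Data.Vec as Vec using (Vec; []; _∷_)
open import Data.List as List using (List; [_]; concatMap; allFin; length; filterᵇ; cartesianProduct)
open import Data.Product using (_×_; _,_; proj₁; proj₂)
open import Data.Integer using (+_)
open import Data.Rational as ℚ using (ℚ; _<_; _-_; 1ℚ; _/_)
open import Data.Sum using (_⊎_)
open import Relation.Nullary.Decidable using (⌊_⌋)

-- A k-partite k-uniform hypergraph on parts W_1,...,W_k with |W_i| = m:
-- we identify W_i with {i} × Fin m.  A k-tuple with exactly one vertex in
-- each W_i is a vector e : Vec (Fin m) k (coordinate i = the vertex in W_i).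
-- The edge set E (all edges of a k-partite hypergraph are such transversal
-- tuples) is given by its (decidable) indicator function.
Hypergraph : ℕ → ℕ → Set
Hypergraph k m = Vec (Fin m) k → Bool

allTuples : (k m : ℕ) → List (Vec (Fin m) k)
allTuples zero    m = [ [] ]
allTuples (suc k) m = concatMap (λ x → List.map (x ∷_) (allTuples k m)) (allFin m)

-- number of coordinates where two tuples differ; |e ∩ e'| = k - diffCount e e'
diffCount : ∀ {k m} → Vec (Fin m) k → Vec (Fin m) k → ℕ
diffCount []       []       = 0
diffCount (x ∷ xs) (y ∷ ys) = (if ⌊ x Fin.≟ y ⌋ then 0 else 1) ℕ.+ diffCount xs ys

edgeCount : ∀ {k m} → Hypergraph k m → ℕ
edgeCount {k} {m} E = length (filterᵇ E (allTuples k m))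

density : ∀ {k m} .{{_ : NonZero m}} → Hypergraph k m → ℚ
density {k} {m} E = (+ edgeCount E / (m ^ k)) {{m^n≢0 m k}}

Homogeneous : ∀ {k m} .{{_ : NonZero m}} → ℚ → Hypergraph k m → Set
Homogeneous ε E = density E < ε ⊎ (1ℚ - ε) < density E

crossPairCount : ∀ {k m} → Hypergraph k m → ℕ
crossPairCount {k} {m} E =
  length (filterᵇ (λ p → E (proj₁ p) ∧ not (E (proj₂ p)) ∧ ⌊ diffCount (proj₁ p) (proj₂ p) ℕ.≟ 1 ⌋)
                  (cartesianProduct (allTuples k m) (allTuples k m)))

module Submission where

-- Write N = m^k for the number of transversal k-tuples, A for the number of
-- edges, B = N - A for the number of non-edges and C for the number of
-- crossing pairs (e, e'), e ∈ E, e' ∉ E, at Hamming distance 1.  The heart of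
-- the proof is the edge-isoperimetric inequality for the grid (Fin m)^k,
--
--     m · A · B ≤ m^k · C,
--
-- proved by induction on k: a pair (xu, yv) with xu ∈ E, yv ∉ E is routed
-- through xv, so either (xu, xv) lies in the cut of the slice at x, or
-- (xv, yv) is a cut pair along the first coordinate; counting multiplicities
-- of this routing gives the inequality.  A computation in ℚ finishes: if the
-- density d = A/N lies in [ε, 1 - ε] then ε(1 - ε) ≤ d(1 - d), hence
-- ε(1 - ε) · m · N² ≤ m · A · B ≤ N · C.

open import Defs

-- Counting with finite sums, and the edge-isoperimetric inequality.
module Counting where

  open import Data.Nat using (ℕ; zero; suc; _+_; _*_; _^_; _≤_; z≤n)
  open import Data.Nat.Properties
  open import Data.Bool using (Bool; true; false; not; _∧_)
  open import Data.Bool.Properties using (∧-inverseʳ; ∧-identityʳ)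
  open import Data.Fin as Fin using (Fin)
  open import Data.Vec using (Vec; []; _∷_)
  open import Data.List using (List; []; _∷_; _++_; map; filterᵇ; length; concatMap; cartesianProduct; tabulate; allFin)
  open import Data.Product using (_×_; _,_)
  open import Relation.Nullary using (yes; no)
  open import Relation.Nullary.Decidable using (⌊_⌋)
  open import Relation.Binary.PropositionalEquality
  open import Function using (_∘_)
  open import Algebra.Properties.Semiring.Sum +-*-semiring
    using (sum; sum-syntax; sum-cong-≗; ∑-distrib-+; ∑-comm; *-distribˡ-sum)

  χ : Bool → ℕ
  χ true  = 1
  χ false = 0

  χ-∧ : ∀ a b → χ (a ∧ b) ≡ χ a * χ b
  χ-∧ true  b = sym (+-identityʳ (χ b))
  χ-∧ false b = refl

  χ-not : ∀ b → χ b + χ (not b) ≡ 1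
  χ-not true  = refl
  χ-not false = refl

  ∑-mono : ∀ {n} {f g : Fin n → ℕ} → (∀ i → f i ≤ g i) → sum f ≤ sum g
  ∑-mono {zero}  f≤g = z≤n
  ∑-mono {suc n} f≤g = +-mono-≤ (f≤g Fin.zero) (∑-mono (f≤g ∘ Fin.suc))

  ∑-const : ∀ n c → ∑[ i < n ] c ≡ n * c
  ∑-const zero    c = refl
  ∑-const (suc n) c = cong (c +_) (∑-const n c)

  δ : ∀ {n} → Fin n → Fin n → ℕ
  δ x y = χ ⌊ x Fin.≟ y ⌋

  δ-suc : ∀ {n} (x y : Fin n) → δ (Fin.suc x) (Fin.suc y) ≡ δ x y
  δ-suc x y with x Fin.≟ y
  ... | yes _ = refl
  ... | no  _ = refl

  ∑-δ : ∀ {n} (x : Fin n) (g : Fin n → ℕ) → ∑[ y < n ] (δ x y * g y) ≡ g x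
  ∑-δ {suc n} Fin.zero g = begin
    g Fin.zero + 0 + ∑[ y < n ] 0  ≡⟨ cong (g Fin.zero + 0 +_) (trans (∑-const n 0) (*-zeroʳ n)) ⟩
    g Fin.zero + 0 + 0             ≡⟨ +-identityʳ _ ⟩
    g Fin.zero + 0                 ≡⟨ +-identityʳ _ ⟩
    g Fin.zero                     ∎
    where open ≡-Reasoning
  ∑-δ {suc n} (Fin.suc x) g =
    trans (sum-cong-≗ {n} (λ y → cong (_* g (Fin.suc y)) (δ-suc x y))) (∑-δ x (g ∘ Fin.suc))

  module _ {m : ℕ} where

    ∑ᵗ : ∀ k → (Vec (Fin m) k → ℕ) → ℕ
    ∑ᵗ zero    f = f []
    ∑ᵗ (suc k) f = ∑[ x < m ] ∑ᵗ k (λ u → f (x ∷ u))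

    ∑ᵗ-cong : ∀ k {f g : Vec (Fin m) k → ℕ} → (∀ u → f u ≡ g u) → ∑ᵗ k f ≡ ∑ᵗ k g
    ∑ᵗ-cong zero    f≡g = f≡g []
    ∑ᵗ-cong (suc k) f≡g = sum-cong-≗ {m} (λ x → ∑ᵗ-cong k (λ u → f≡g (x ∷ u)))

    ∑ᵗ-mono : ∀ k {f g : Vec (Fin m) k → ℕ} → (∀ u → f u ≤ g u) → ∑ᵗ k f ≤ ∑ᵗ k g
    ∑ᵗ-mono zero    f≤g = f≤g []
    ∑ᵗ-mono (suc k) f≤g = ∑-mono (λ x → ∑ᵗ-mono k (λ u → f≤g (x ∷ u)))

    ∑ᵗ-distrib-+ : ∀ k (f g : Vec (Fin m) k → ℕ) → ∑ᵗ k (λ u → f u + g u) ≡ ∑ᵗ k f + ∑ᵗ k g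
    ∑ᵗ-distrib-+ zero    f g = refl
    ∑ᵗ-distrib-+ (suc k) f g =
      trans (sum-cong-≗ {m} (λ x → ∑ᵗ-distrib-+ k _ _)) (∑-distrib-+ {m} _ _)

    ∑ᵗ-distribˡ-* : ∀ k c (f : Vec (Fin m) k → ℕ) → c * ∑ᵗ k f ≡ ∑ᵗ k (λ u → c * f u)
    ∑ᵗ-distribˡ-* zero    c f = refl
    ∑ᵗ-distribˡ-* (suc k) c f =
      trans (*-distribˡ-sum {m} c _) (sum-cong-≗ {m} (λ x → ∑ᵗ-distribˡ-* k c _))

    ∑ᵗ-const : ∀ k c → ∑ᵗ k (λ _ → c) ≡ m ^ k * c
    ∑ᵗ-const zero    c = sym (+-identityʳ c)
    ∑ᵗ-const (suc k) c = begin
      ∑[ x < m ] ∑ᵗ k (λ _ → c)  ≡⟨ sum-cong-≗ {m} (λ _ → ∑ᵗ-const k c) ⟩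
      ∑[ x < m ] (m ^ k * c)     ≡⟨ ∑-const m _ ⟩
      m * (m ^ k * c)            ≡⟨ *-assoc m (m ^ k) c ⟨
      m ^ suc k * c              ∎
      where open ≡-Reasoning

    ∑ᵗ-comm : ∀ k {p} (f : Fin p → Vec (Fin m) k → ℕ) →
              ∑ᵗ k (λ u → ∑[ y < p ] f y u) ≡ ∑[ y < p ] ∑ᵗ k (f y)
    ∑ᵗ-comm zero    f = refl
    ∑ᵗ-comm (suc k) {p} f =
      trans (sum-cong-≗ {m} (λ x → ∑ᵗ-comm k (λ y u → f y (x ∷ u)))) (∑-comm {m} {p} _)

    δᵗ : ∀ {k} → Vec (Fin m) k → Vec (Fin m) k → ℕ
    δᵗ u v = χ ⌊ diffCount u v ≟ 0 ⌋

    δᵗ-∷ : ∀ {k} x y (u v : Vec (Fin m) k) → δᵗ (x ∷ u) (y ∷ v) ≡ δ x y * δᵗ u v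
    δᵗ-∷ x y u v with x Fin.≟ y
    ... | yes _ = sym (+-identityʳ (δᵗ u v))
    ... | no  _ = refl

    ∑ᵗ-δ : ∀ k (u : Vec (Fin m) k) (g : Vec (Fin m) k → ℕ) → ∑ᵗ k (λ v → δᵗ u v * g v) ≡ g u
    ∑ᵗ-δ zero    [] g = +-identityʳ (g [])
    ∑ᵗ-δ (suc k) (x ∷ u) g = begin
      ∑[ y < m ] ∑ᵗ k (λ v → δᵗ (x ∷ u) (y ∷ v) * g (y ∷ v))
        ≡⟨ sum-cong-≗ {m} (λ y → ∑ᵗ-cong k (λ v →
             trans (cong (_* g (y ∷ v)) (δᵗ-∷ x y u v)) (*-assoc (δ x y) _ _))) ⟩
      ∑[ y < m ] ∑ᵗ k (λ v → δ x y * (δᵗ u v * g (y ∷ v)))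
        ≡⟨ sum-cong-≗ {m} (λ y → ∑ᵗ-distribˡ-* k (δ x y) _) ⟨
      ∑[ y < m ] (δ x y * ∑ᵗ k (λ v → δᵗ u v * g (y ∷ v)))
        ≡⟨ ∑-δ x _ ⟩
      ∑ᵗ k (λ v → δᵗ u v * g (x ∷ v))
        ≡⟨ ∑ᵗ-δ k u (g ∘ (x ∷_)) ⟩
      g (x ∷ u) ∎
      where open ≡-Reasoning

  Σˡ : ∀ {A : Set} → (A → ℕ) → List A → ℕ
  Σˡ f []       = 0
  Σˡ f (x ∷ xs) = f x + Σˡ f xs

  length-filter : ∀ {A : Set} (p : A → Bool) xs → length (filterᵇ p xs) ≡ Σˡ (χ ∘ p) xs
  length-filter p []       = refl
  length-filter p (x ∷ xs) with p x
  ... | true  = cong suc (length-filter p xs)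
  ... | false = length-filter p xs

  Σˡ-cong : ∀ {A : Set} {f g : A → ℕ} xs → (∀ x → f x ≡ g x) → Σˡ f xs ≡ Σˡ g xs
  Σˡ-cong []       f≡g = refl
  Σˡ-cong (x ∷ xs) f≡g = cong₂ _+_ (f≡g x) (Σˡ-cong xs f≡g)

  Σˡ-++ : ∀ {A : Set} (f : A → ℕ) xs ys → Σˡ f (xs ++ ys) ≡ Σˡ f xs + Σˡ f ys
  Σˡ-++ f []       ys = refl
  Σˡ-++ f (x ∷ xs) ys = trans (cong (f x +_) (Σˡ-++ f xs ys)) (sym (+-assoc (f x) _ _))

  Σˡ-map : ∀ {A B : Set} (f : B → ℕ) (g : A → B) xs → Σˡ f (map g xs) ≡ Σˡ (f ∘ g) xs
  Σˡ-map f g []       = refl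
  Σˡ-map f g (x ∷ xs) = cong (f (g x) +_) (Σˡ-map f g xs)

  Σˡ-concatMap : ∀ {A B : Set} (f : B → ℕ) (g : A → List B) xs →
                 Σˡ f (concatMap g xs) ≡ Σˡ (Σˡ f ∘ g) xs
  Σˡ-concatMap f g []       = refl
  Σˡ-concatMap f g (x ∷ xs) =
    trans (Σˡ-++ f (g x) (concatMap g xs)) (cong (Σˡ f (g x) +_) (Σˡ-concatMap f g xs))

  Σˡ-cartesianProduct : ∀ {A B : Set} (f : A × B → ℕ) (xs : List A) (ys : List B) →
    Σˡ f (cartesianProduct xs ys) ≡ Σˡ (λ x → Σˡ (λ y → f (x , y)) ys) xs
  Σˡ-cartesianProduct f []       ys = refl
  Σˡ-cartesianProduct f (x ∷ xs) ys =
    trans (Σˡ-++ f (map (x ,_) ys) (cartesianProduct xs ys))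
          (cong₂ _+_ (Σˡ-map f (x ,_) ys) (Σˡ-cartesianProduct f xs ys))

  Σˡ-tabulate : ∀ {n} {A : Set} (f : A → ℕ) (g : Fin n → A) → Σˡ f (tabulate g) ≡ sum (f ∘ g)
  Σˡ-tabulate {zero}  f g = refl
  Σˡ-tabulate {suc n} f g = cong (f (g Fin.zero) +_) (Σˡ-tabulate f (g ∘ Fin.suc))

  Σˡ-allTuples : ∀ {m} k (f : Vec (Fin m) k → ℕ) → Σˡ f (allTuples k m) ≡ ∑ᵗ k f
  Σˡ-allTuples zero        f = +-identityʳ (f [])
  Σˡ-allTuples {m} (suc k) f = begin
    Σˡ f (concatMap (λ x → map (x ∷_) (allTuples k m)) (allFin m))
      ≡⟨ Σˡ-concatMap f _ (allFin m) ⟩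
    Σˡ (λ x → Σˡ f (map (x ∷_) (allTuples k m))) (allFin m)
      ≡⟨ Σˡ-cong (allFin m) (λ x → trans (Σˡ-map f (x ∷_) (allTuples k m)) (Σˡ-allTuples k (f ∘ (x ∷_)))) ⟩
    Σˡ (λ x → ∑ᵗ k (f ∘ (x ∷_))) (allFin m)
      ≡⟨ Σˡ-tabulate {m} (λ x → ∑ᵗ k (f ∘ (x ∷_))) (λ x → x) ⟩
    ∑ᵗ (suc k) f ∎
    where open ≡-Reasoning

  diffCount≡0⇒≡ : ∀ {m k} (u v : Vec (Fin m) k) → diffCount u v ≡ 0 → u ≡ v
  diffCount≡0⇒≡ []      []      _ = refl
  diffCount≡0⇒≡ (x ∷ u) (y ∷ v) d≡0 with x Fin.≟ y
  ... | yes refl = cong (x ∷_) (diffCount≡0⇒≡ u v d≡0)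
  diffCount≡0⇒≡ (x ∷ u) (y ∷ v) () | no _

  module _ {m : ℕ} where

    cut : ∀ {k} → Hypergraph k m → ℕ
    cut {k} E = ∑ᵗ k λ u → ∑ᵗ k λ v → χ (E u ∧ not (E v))

    cross : ∀ {k} → Hypergraph k m → ℕ
    cross {k} E = ∑ᵗ k λ u → ∑ᵗ k λ v → χ (E u ∧ not (E v) ∧ ⌊ diffCount u v ≟ 1 ⌋)

    slice : ∀ {k} → Hypergraph (suc k) m → Fin m → Hypergraph k m
    slice E x u = E (x ∷ u)

    line : ∀ {k} → Hypergraph (suc k) m → ℕ
    line {k} E = ∑[ x < m ] ∑[ y < m ] ∑ᵗ k λ v → χ (E (x ∷ v) ∧ not (E (y ∷ v)))

    -- Routing a cut pair (a, c) through b: one of (a, b), (b, c) is in the cut.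
    route : ∀ a b c → χ (a ∧ not c) ≤ χ (a ∧ not b) + χ (b ∧ not c)
    route true  true  true  = z≤n
    route true  true  false = ≤-refl
    route true  false true  = z≤n
    route true  false false = ≤-refl
    route false _     _     = z≤n

    -- Routing every cut pair (xu, yv) through xv bounds the cut by the cuts
    -- of the slices (each counted once per y) plus the line pairs (each
    -- counted once per u).
    cut-split : ∀ {k} (E : Hypergraph (suc k) m) →
                cut E ≤ m * ∑[ x < m ] cut (slice E x) + m ^ k * line E
    cut-split {k} E = begin
      cut E
        ≤⟨ ∑-mono (λ x → ∑ᵗ-mono k (λ u → ∑-mono (λ y → ∑ᵗ-mono k (λ v →
             route (E (x ∷ u)) (E (x ∷ v)) (E (y ∷ v)))))) ⟩
      ∑[ x < m ] ∑ᵗ k (λ u → ∑[ y < m ] ∑ᵗ k (λ v → P x u v + Q x y v))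
        ≡⟨ sum-cong-≗ {m} (λ x → ∑ᵗ-cong k (λ u → inner x u)) ⟩
      ∑[ x < m ] ∑ᵗ k (λ u → m * ∑ᵗ k (P x u) + L x)
        ≡⟨ sum-cong-≗ {m} middle ⟩
      ∑[ x < m ] (m * cut (slice E x) + m ^ k * L x)
        ≡⟨ ∑-distrib-+ {m} _ _ ⟩
      ∑[ x < m ] (m * cut (slice E x)) + ∑[ x < m ] (m ^ k * L x)
        ≡⟨ cong₂ _+_ (*-distribˡ-sum {m} m _) (*-distribˡ-sum {m} (m ^ k) L) ⟨
      m * ∑[ x < m ] cut (slice E x) + m ^ k * line E ∎
      where
      open ≤-Reasoning
      P : Fin m → Vec (Fin m) k → Vec (Fin m) k → ℕ
      P x u v = χ (E (x ∷ u) ∧ not (E (x ∷ v)))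
      Q : Fin m → Fin m → Vec (Fin m) k → ℕ
      Q x y v = χ (E (x ∷ v) ∧ not (E (y ∷ v)))
      L : Fin m → ℕ
      L x = ∑[ y < m ] ∑ᵗ k (Q x y)
      inner : ∀ x u → ∑[ y < m ] ∑ᵗ k (λ v → P x u v + Q x y v) ≡ m * ∑ᵗ k (P x u) + L x
      inner x u = trans (sum-cong-≗ {m} (λ y → ∑ᵗ-distrib-+ k (P x u) (Q x y)))
                 (trans (∑-distrib-+ {m} _ _) (cong (_+ L x) (∑-const m _)))
      middle : ∀ x → ∑ᵗ k (λ u → m * ∑ᵗ k (P x u) + L x) ≡ m * cut (slice E x) + m ^ k * L x
      middle x = trans (∑ᵗ-distrib-+ k _ _)
                 (cong₂ _+_ (sym (∑ᵗ-distribˡ-* k m _)) (∑ᵗ-const k (L x)))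

    -- A pair (xu, yv) is crossing iff either x = y and (u, v) is crossing,
    -- or u = v and the pair differs in the first coordinate only.
    cross-cases : ∀ {k} (E : Hypergraph (suc k) m) x y u v →
      δ x y * χ (E (x ∷ u) ∧ not (E (x ∷ v)) ∧ ⌊ diffCount u v ≟ 1 ⌋)
        + δᵗ u v * χ (E (x ∷ v) ∧ not (E (y ∷ v)))
      ≤ χ (E (x ∷ u) ∧ not (E (y ∷ v)) ∧ ⌊ diffCount (x ∷ u) (y ∷ v) ≟ 1 ⌋)
    cross-cases E x y u v with x Fin.≟ y
    ... | yes refl rewrite ∧-inverseʳ (E (x ∷ v)) | *-zeroʳ (δᵗ u v) =
      ≤-reflexive (trans (+-identityʳ _) (+-identityʳ _))
    ... | no _ with diffCount u v | diffCount≡0⇒≡ u v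
    ...   | suc _ | _   = z≤n
    ...   | zero  | u≡v rewrite u≡v refl | ∧-identityʳ (not (E (y ∷ v))) =
      ≤-reflexive (+-identityʳ _)

    -- Conversely the crossing pairs of E contain, disjointly, the crossing
    -- pairs of every slice and every line pair with distinct first coordinates.
    cross-split : ∀ {k} (E : Hypergraph (suc k) m) →
                  ∑[ x < m ] cross (slice E x) + line E ≤ cross E
    cross-split {k} E = begin
      ∑[ x < m ] cross (slice E x) + line E
        ≡⟨ ∑-distrib-+ {m} _ _ ⟨
      ∑[ x < m ] (cross (slice E x) + L x)
        ≡⟨ sum-cong-≗ {m} regroup ⟩
      ∑[ x < m ] ∑ᵗ k (λ u → ∑ᵗ k (C x u) + ∑[ y < m ] Q x y u)
        ≡⟨ sum-cong-≗ {m} (λ x → ∑ᵗ-cong k (deltas x)) ⟩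
      ∑[ x < m ] ∑ᵗ k (λ u → ∑[ y < m ] ∑ᵗ k (λ v → δ x y * C x u v + δᵗ u v * Q x y v))
        ≤⟨ ∑-mono (λ x → ∑ᵗ-mono k (λ u → ∑-mono (λ y → ∑ᵗ-mono k (λ v →
             cross-cases E x y u v)))) ⟩
      cross E ∎
      where
      open ≤-Reasoning
      C : Fin m → Vec (Fin m) k → Vec (Fin m) k → ℕ
      C x u v = χ (E (x ∷ u) ∧ not (E (x ∷ v)) ∧ ⌊ diffCount u v ≟ 1 ⌋)
      Q : Fin m → Fin m → Vec (Fin m) k → ℕ
      Q x y v = χ (E (x ∷ v) ∧ not (E (y ∷ v)))
      L : Fin m → ℕ
      L x = ∑[ y < m ] ∑ᵗ k (Q x y)
      regroup : ∀ x → cross (slice E x) + L x ≡ ∑ᵗ k (λ u → ∑ᵗ k (C x u) + ∑[ y < m ] Q x y u)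
      regroup x = trans (cong (cross (slice E x) +_) (sym (∑ᵗ-comm k (Q x))))
                        (sym (∑ᵗ-distrib-+ k _ _))
      -- Insert the deltas selecting y = x in the first summand and v = u in the second.
      deltas : ∀ x u → ∑ᵗ k (C x u) + ∑[ y < m ] Q x y u
                     ≡ ∑[ y < m ] ∑ᵗ k (λ v → δ x y * C x u v + δᵗ u v * Q x y v)
      deltas x u = begin-equality
        ∑ᵗ k (C x u) + ∑[ y < m ] Q x y u
          ≡⟨ cong₂ _+_ (∑-δ x (λ _ → ∑ᵗ k (C x u))) (sum-cong-≗ {m} (λ y → ∑ᵗ-δ k u (Q x y))) ⟨
        ∑[ y < m ] (δ x y * ∑ᵗ k (C x u)) + ∑[ y < m ] ∑ᵗ k (λ v → δᵗ u v * Q x y v)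
          ≡⟨ ∑-distrib-+ {m} _ _ ⟨
        ∑[ y < m ] (δ x y * ∑ᵗ k (C x u) + ∑ᵗ k (λ v → δᵗ u v * Q x y v))
          ≡⟨ sum-cong-≗ {m} (λ y → trans (cong (_+ ∑ᵗ k (λ v → δᵗ u v * Q x y v)) (∑ᵗ-distribˡ-* k (δ x y) (C x u)))
                                         (sym (∑ᵗ-distrib-+ k _ _))) ⟩
        ∑[ y < m ] ∑ᵗ k (λ v → δ x y * C x u v + δᵗ u v * Q x y v) ∎

    isoperimetric : ∀ k (E : Hypergraph k m) → m * cut E ≤ m ^ k * cross E
    isoperimetric zero E rewrite ∧-inverseʳ (E []) | *-zeroʳ m = z≤n
    isoperimetric (suc k) E = begin
      m * cut E
        ≤⟨ *-monoʳ-≤ m (cut-split E) ⟩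
      m * (m * Σcut + m ^ k * line E)
        ≡⟨ *-distribˡ-+ m _ _ ⟩
      m * (m * Σcut) + m * (m ^ k * line E)
        ≤⟨ +-monoˡ-≤ _ slices ⟩
      m * (m ^ k * Σcross) + m * (m ^ k * line E)
        ≡⟨ *-distribˡ-+ m _ _ ⟨
      m * (m ^ k * Σcross + m ^ k * line E)
        ≡⟨ cong (m *_) (*-distribˡ-+ (m ^ k) Σcross (line E)) ⟨
      m * (m ^ k * (Σcross + line E))
        ≡⟨ *-assoc m (m ^ k) _ ⟨
      m ^ suc k * (Σcross + line E)
        ≤⟨ *-monoʳ-≤ (m ^ suc k) (cross-split E) ⟩
      m ^ suc k * cross E ∎
      where
      open ≤-Reasoning
      Σcut Σcross : ℕ
      Σcut   = ∑[ x < m ] cut (slice E x)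
      Σcross = ∑[ x < m ] cross (slice E x)
      slices : m * (m * Σcut) ≤ m * (m ^ k * Σcross)
      slices = *-monoʳ-≤ m (begin
        m * Σcut                              ≡⟨ *-distribˡ-sum {m} m _ ⟩
        ∑[ x < m ] (m * cut (slice E x))       ≤⟨ ∑-mono (λ x → isoperimetric k (slice E x)) ⟩
        ∑[ x < m ] (m ^ k * cross (slice E x)) ≡⟨ *-distribˡ-sum {m} (m ^ k) _ ⟨
        m ^ k * Σcross                        ∎)

    nonEdges : ∀ {k} → Hypergraph k m → ℕ
    nonEdges {k} E = ∑ᵗ k (χ ∘ not ∘ E)

    edgeCount≡∑ᵗ : ∀ {k} (E : Hypergraph k m) → edgeCount E ≡ ∑ᵗ k (χ ∘ E)
    edgeCount≡∑ᵗ {k} E = trans (length-filter E (allTuples k m)) (Σˡ-allTuples k (χ ∘ E))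

    crossPairCount≡cross : ∀ {k} (E : Hypergraph k m) → crossPairCount E ≡ cross E
    crossPairCount≡cross {k} E = begin
      crossPairCount E
        ≡⟨ length-filter crossing (cartesianProduct tuples tuples) ⟩
      Σˡ (χ ∘ crossing) (cartesianProduct tuples tuples)
        ≡⟨ Σˡ-cartesianProduct (χ ∘ crossing) tuples tuples ⟩
      Σˡ (λ u → Σˡ (λ v → χ (crossing (u , v))) tuples) tuples
        ≡⟨ Σˡ-cong tuples (λ u → Σˡ-allTuples k (λ v → χ (crossing (u , v)))) ⟩
      Σˡ (λ u → ∑ᵗ k (λ v → χ (crossing (u , v)))) tuples
        ≡⟨ Σˡ-allTuples k _ ⟩
      cross E ∎
      where
      open ≡-Reasoning
      tuples : List (Vec (Fin m) k)
      tuples = allTuples k m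
      crossing : Vec (Fin m) k × Vec (Fin m) k → Bool
      crossing (u , v) = E u ∧ not (E v) ∧ ⌊ diffCount u v ≟ 1 ⌋

    edges+nonEdges : ∀ {k} (E : Hypergraph k m) → edgeCount E + nonEdges E ≡ m ^ k
    edges+nonEdges {k} E = begin
      edgeCount E + nonEdges E            ≡⟨ cong (_+ nonEdges E) (edgeCount≡∑ᵗ E) ⟩
      ∑ᵗ k (χ ∘ E) + nonEdges E           ≡⟨ ∑ᵗ-distrib-+ k _ _ ⟨
      ∑ᵗ k (λ u → χ (E u) + χ (not (E u))) ≡⟨ ∑ᵗ-cong k (χ-not ∘ E) ⟩
      ∑ᵗ k (λ _ → 1)                      ≡⟨ ∑ᵗ-const k 1 ⟩
      m ^ k * 1                           ≡⟨ *-identityʳ (m ^ k) ⟩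
      m ^ k                               ∎
      where open ≡-Reasoning

    -- The cut is the complete bipartite graph between edges and non-edges.
    cut≡edges*nonEdges : ∀ {k} (E : Hypergraph k m) → cut E ≡ edgeCount E * nonEdges E
    cut≡edges*nonEdges {k} E = begin
      cut E
        ≡⟨ ∑ᵗ-cong k (λ u → ∑ᵗ-cong k (λ v → χ-∧ (E u) (not (E v)))) ⟩
      ∑ᵗ k (λ u → ∑ᵗ k (λ v → χ (E u) * χ (not (E v))))
        ≡⟨ ∑ᵗ-cong k (λ u → ∑ᵗ-distribˡ-* k (χ (E u)) _) ⟨
      ∑ᵗ k (λ u → χ (E u) * nonEdges E)
        ≡⟨ ∑ᵗ-cong k (λ u → *-comm (χ (E u)) (nonEdges E)) ⟩
      ∑ᵗ k (λ u → nonEdges E * χ (E u))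
        ≡⟨ ∑ᵗ-distribˡ-* k (nonEdges E) (χ ∘ E) ⟨
      nonEdges E * ∑ᵗ k (χ ∘ E)
        ≡⟨ *-comm (nonEdges E) _ ⟩
      ∑ᵗ k (χ ∘ E) * nonEdges E
        ≡⟨ cong (_* nonEdges E) (edgeCount≡∑ᵗ E) ⟨
      edgeCount E * nonEdges E ∎
      where open ≡-Reasoning

    crossing-bound : ∀ {k} (E : Hypergraph k m) →
                     m * (edgeCount E * nonEdges E) ≤ m ^ k * crossPairCount E
    crossing-bound {k} E = begin
      m * (edgeCount E * nonEdges E) ≡⟨ cong (m *_) (cut≡edges*nonEdges E) ⟨
      m * cut E                      ≤⟨ isoperimetric k E ⟩
      m ^ k * cross E                ≡⟨ cong (m ^ k *_) (crossPairCount≡cross E) ⟨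
      m ^ k * crossPairCount E       ∎
      where open ≤-Reasoning

-- Arithmetic in ℚ: the embedding of ℕ and the final inequality.
module Density where

  open import Data.Nat as ℕ using (ℕ; suc; NonZero)
  import Data.Nat.Properties as ℕ
  open import Data.Integer as ℤ using (+_)
  import Data.Integer.Properties as ℤ
  open import Data.Rational using (ℚ; _≤_; _+_; _*_; _-_; -_; 0ℚ; 1ℚ; _/_; toℚᵘ; NonNegative; nonNegative)
  open import Data.Rational.Properties
  open import Data.Rational.Unnormalised as ℚᵘ using (mkℚᵘ; *≡*; *≤*) renaming (_≃_ to _≃ᵘ_)
  import Data.Rational.Unnormalised.Properties as ℚᵘ
  open import Data.Rational.Solver using (module +-*-Solver)
  open import Relation.Binary.PropositionalEquality
  open +-*-Solver

  ⌜_⌝ : ℕ → ℚ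
  ⌜ a ⌝ = + a / 1

  -- Read in the unnormalised rationals, a / (suc n) is literally the pair (a, n).
  toℚᵘ-/ : ∀ a n → toℚᵘ (+ a / suc n) ≃ᵘ mkℚᵘ (+ a) n
  toℚᵘ-/ a n = toℚᵘ-fromℚᵘ (mkℚᵘ (+ a) n)

  ⌜⌝-+ : ∀ a b → ⌜ a ℕ.+ b ⌝ ≡ ⌜ a ⌝ + ⌜ b ⌝
  ⌜⌝-+ a b = toℚᵘ-injective (ℚᵘ.≃-trans (toℚᵘ-/ (a ℕ.+ b) 0) (ℚᵘ.≃-trans sumᵘ (ℚᵘ.≃-sym
    (ℚᵘ.≃-trans (toℚᵘ-homo-+ ⌜ a ⌝ ⌜ b ⌝) (ℚᵘ.+-cong (toℚᵘ-/ a 0) (toℚᵘ-/ b 0))))))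
    where
    sumᵘ : mkℚᵘ (+ (a ℕ.+ b)) 0 ≃ᵘ mkℚᵘ (+ a) 0 ℚᵘ.+ mkℚᵘ (+ b) 0
    sumᵘ = *≡* (cong (ℤ._* + 1) (trans (ℤ.pos-+ a b)
             (sym (cong₂ ℤ._+_ (ℤ.*-identityʳ (+ a)) (ℤ.*-identityʳ (+ b))))))

  ⌜⌝-* : ∀ a b → ⌜ a ℕ.* b ⌝ ≡ ⌜ a ⌝ * ⌜ b ⌝
  ⌜⌝-* a b = toℚᵘ-injective (ℚᵘ.≃-trans (toℚᵘ-/ (a ℕ.* b) 0) (ℚᵘ.≃-trans productᵘ (ℚᵘ.≃-sym
    (ℚᵘ.≃-trans (toℚᵘ-homo-* ⌜ a ⌝ ⌜ b ⌝) (ℚᵘ.*-cong (toℚᵘ-/ a 0) (toℚᵘ-/ b 0))))))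
    where
    productᵘ : mkℚᵘ (+ (a ℕ.* b)) 0 ≃ᵘ mkℚᵘ (+ a) 0 ℚᵘ.* mkℚᵘ (+ b) 0
    productᵘ = *≡* (cong (ℤ._* + 1) (ℤ.pos-* a b))

  ⌜⌝-mono : ∀ {a b} → a ℕ.≤ b → ⌜ a ⌝ ≤ ⌜ b ⌝
  ⌜⌝-mono {a} {b} a≤b = toℚᵘ-cancel-≤ (ℚᵘ.≤-respʳ-≃ (ℚᵘ.≃-sym (toℚᵘ-/ b 0))
    (ℚᵘ.≤-respˡ-≃ (ℚᵘ.≃-sym (toℚᵘ-/ a 0)) (*≤* (ℤ.*-monoʳ-≤-nonNeg (+ 1) (ℤ.+≤+ a≤b)))))

  ⌜⌝-nonNeg : ∀ a → NonNegative ⌜ a ⌝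
  ⌜⌝-nonNeg a = normalize-nonNeg a 1

  /-*-cancel : ∀ a N .{{_ : NonZero N}} → (+ a / N) * ⌜ N ⌝ ≡ ⌜ a ⌝
  /-*-cancel a (suc n) = toℚᵘ-injective (ℚᵘ.≃-trans (toℚᵘ-homo-* (+ a / suc n) ⌜ suc n ⌝)
    (ℚᵘ.≃-trans (ℚᵘ.*-cong (toℚᵘ-/ a n) (toℚᵘ-/ (suc n) 0)) (ℚᵘ.≃-sym (ℚᵘ.≃-trans (toℚᵘ-/ a 0) cancelᵘ))))
    where
    cancelᵘ : mkℚᵘ (+ a) 0 ≃ᵘ mkℚᵘ (+ a) n ℚᵘ.* mkℚᵘ (+ suc n) 0
    cancelᵘ = *≡* (trans (cong (λ z → + a ℤ.* + z) (ℕ.*-identityʳ (suc n))) (sym (ℤ.*-identityʳ _)))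

  ≤⇒0≤- : ∀ {p q} → p ≤ q → 0ℚ ≤ q - p
  ≤⇒0≤- {p} {q} p≤q = subst (_≤ q - p) (+-inverseʳ p) (+-monoˡ-≤ (- p) p≤q)

  -- t(1 - t) is minimised on [ε, 1 - ε] at the endpoints, because
  -- d(1 - d) - ε(1 - ε) = (d - ε)(1 - ε - d).
  product-bound : ∀ {ε d} → ε ≤ d → d ≤ 1ℚ - ε → ε * (1ℚ - ε) ≤ d * (1ℚ - d)
  product-bound {ε} {d} ε≤d d≤1-ε = begin
    ε * (1ℚ - ε)               ≡⟨ +-identityʳ _ ⟨
    ε * (1ℚ - ε) + 0ℚ          ≤⟨ +-monoʳ-≤ (ε * (1ℚ - ε)) gap≥0 ⟩
    ε * (1ℚ - ε) + x * y       ≡⟨ solve 2 (λ d e → e :* (con 1ℚ :- e) :+ (d :- e) :* ((con 1ℚ :- e) :- d)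
                                                 := d :* (con 1ℚ :- d)) refl d ε ⟩
    d * (1ℚ - d)               ∎
    where
    open ≤-Reasoning
    x y : ℚ
    x = d - ε
    y = (1ℚ - ε) - d
    gap≥0 : 0ℚ ≤ x * y
    gap≥0 = subst (_≤ x * y) (*-zeroˡ y)
              (*-monoʳ-≤-nonNeg y {{nonNegative (≤⇒0≤- d≤1-ε)}} (≤⇒0≤- ε≤d))

  density-bound : ∀ (ε : ℚ) (A B C m N : ℕ) .{{_ : NonZero N}} →
    ε ≤ (+ A / N) → (+ A / N) ≤ 1ℚ - ε →
    A ℕ.+ B ≡ N → m ℕ.* (A ℕ.* B) ℕ.≤ N ℕ.* C →
    ε * (1ℚ - ε) * ⌜ m ℕ.* N ⌝ ≤ ⌜ C ⌝
  density-bound ε A B C m N ε≤d d≤1-ε A+B≡N mAB≤NC =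
    *-cancelʳ-≤-pos ⌜ N ⌝ {{normalize-pos N 1}} (begin
      ε * (1ℚ - ε) * ⌜ m ℕ.* N ⌝ * ⌜ N ⌝
        ≡⟨ cong (λ z → ε * (1ℚ - ε) * z * ⌜ N ⌝) (⌜⌝-* m N) ⟩
      ε * (1ℚ - ε) * (⌜ m ⌝ * ⌜ N ⌝) * ⌜ N ⌝
        ≡⟨ solve 3 (λ r a n → r :* (a :* n) :* n := r :* (a :* (n :* n))) refl (ε * (1ℚ - ε)) ⌜ m ⌝ ⌜ N ⌝ ⟩
      ε * (1ℚ - ε) * mN²
        ≤⟨ *-monoʳ-≤-nonNeg mN² {{mN²≥0}} (product-bound ε≤d d≤1-ε) ⟩
      d * (1ℚ - d) * mN²
        ≡⟨ solve 4 (λ d e a n → d :* e :* (a :* (n :* n)) := a :* ((d :* n) :* (e :* n))) refl d (1ℚ - d) ⌜ m ⌝ ⌜ N ⌝ ⟩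
      ⌜ m ⌝ * ((d * ⌜ N ⌝) * ((1ℚ - d) * ⌜ N ⌝))
        ≡⟨ cong₂ (λ s t → ⌜ m ⌝ * (s * t)) (/-*-cancel A N) complement ⟩
      ⌜ m ⌝ * (⌜ A ⌝ * ⌜ B ⌝)
        ≡⟨ trans (⌜⌝-* m (A ℕ.* B)) (cong (⌜ m ⌝ *_) (⌜⌝-* A B)) ⟨
      ⌜ m ℕ.* (A ℕ.* B) ⌝
        ≤⟨ ⌜⌝-mono mAB≤NC ⟩
      ⌜ N ℕ.* C ⌝
        ≡⟨ trans (⌜⌝-* N C) (*-comm ⌜ N ⌝ ⌜ C ⌝) ⟩
      ⌜ C ⌝ * ⌜ N ⌝ ∎)
    where
    open ≤-Reasoning
    d mN² : ℚ
    d   = + A / N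
    mN² = ⌜ m ⌝ * (⌜ N ⌝ * ⌜ N ⌝)
    mN²≥0 : NonNegative mN²
    mN²≥0 = nonNeg*nonNeg⇒nonNeg ⌜ m ⌝ {{⌜⌝-nonNeg m}} (⌜ N ⌝ * ⌜ N ⌝)
              {{nonNeg*nonNeg⇒nonNeg ⌜ N ⌝ {{⌜⌝-nonNeg N}} ⌜ N ⌝ {{⌜⌝-nonNeg N}}}}
    complement : (1ℚ - d) * ⌜ N ⌝ ≡ ⌜ B ⌝
    complement = begin-equality
      (1ℚ - d) * ⌜ N ⌝         ≡⟨ solve 2 (λ d n → (con 1ℚ :- d) :* n := n :- d :* n) refl d ⌜ N ⌝ ⟩
      ⌜ N ⌝ - d * ⌜ N ⌝        ≡⟨ cong₂ _-_ (trans (cong ⌜_⌝ (sym A+B≡N)) (⌜⌝-+ A B)) (/-*-cancel A N) ⟩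
      (⌜ A ⌝ + ⌜ B ⌝) - ⌜ A ⌝  ≡⟨ solve 2 (λ a b → (a :+ b) :- a := b) refl ⌜ A ⌝ ⌜ B ⌝ ⟩
      ⌜ B ⌝                    ∎

open import Data.Nat using (ℕ; NonZero; _≤_; _^_; suc)
open import Data.Nat.Properties using (m^n≢0)
open import Data.Integer using (+_)
open import Data.Rational using (ℚ; _<_; _*_; _-_; 0ℚ; 1ℚ; ½; _/_)
open import Data.Rational using () renaming (_≤_ to _≤ℚ_)
open import Data.Rational.Properties using (≮⇒≥)
open import Data.Sum using (inj₁; inj₂)
open import Relation.Nullary using (¬_)
open import Function using (_∘_)
open Counting using (nonEdges; edges+nonEdges; crossing-bound)
open Density using (density-bound)

-- Non-homogeneity places the density in [ε, 1 - ε]; the isoperimetric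
-- inequality and the rational estimate then give the bound.
mainTheorem9 : (ε : ℚ) → 0ℚ < ε → ε < ½ → (k : ℕ) → 2 ≤ k → (m : ℕ) → .{{_ : NonZero m}}
    → (E : Hypergraph k m) → ¬ Homogeneous ε E
    → ε * (1ℚ - ε) * (+ (m ^ (suc k)) / 1) ≤ℚ (+ crossPairCount E / 1)
mainTheorem9 ε _ _ k _ m E nonHomogeneous =
  density-bound ε (edgeCount E) (nonEdges E) (crossPairCount E) m (m ^ k) {{m^n≢0 m k}}
    (≮⇒≥ (nonHomogeneous ∘ inj₁)) (≮⇒≥ (nonHomogeneous ∘ inj₂))
    (edges+nonEdges E) (crossing-bound E)
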